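{- Let $n\geq 3$ and let $f\in F(n)$ with $f\neq\mathrm{id}$. Suppose that $f$ does not contain $2P_1$ and that $f$ has at least $2$ periodic configurations. Then there exists $h\in F(n)$ with $h\sim f$ and $|\Delta^+(h)|\neq|\Delta^+(f)|$.
   Context: $F(n)$ is the set of all functions $\{0,1\}^n\to\{0,1\}^n$. $f$ contains $2P_1$ if there exist configurations $x,y$ such that $x,y,f(x),f(y)$ are pairwise distinct. A periodic configuration of $f$ is a configuration lying on a cycle of the digraph $\mathcal{S}(f)$ (the digraph on $\{0,1\}^n$ with an arc $x\to f(x)$), i.e. $f^k(x)=x$ for some $k\geq1$. $\bar x$ is $x$ with every component flipped; $\Delta^+(f)=\{x: f(x)=\bar x\}$. $f\sim h$ means $\mathcal{S}(f)$ and $\mathcal{S}(h)$ are isomorphic. -}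

module Defs where

open import Data.Nat using (ℕ; zero; suc; _≥_)
open import Data.Bool using (Bool; true; false; not)
open import Data.Bool.Properties using () renaming (_≟_ to _≟B_)
open import Data.Vec using (Vec; []; _∷_; map)
open import Data.Vec.Properties using (≡-dec)
open import Data.List using (List; []; _∷_; _++_; length; filter)
import Data.List as L
open import Data.Product using (Σ; ∃; _×_; _,_)
open import Relation.Binary.PropositionalEquality using (_≡_; _≢_)
open import Relation.Nullary using (Dec; ¬_)
open import Function.Bundles using (_⤖_; Bijection)
open import Function.Base using (id)

Config : ℕ → Set
Config n = Vec Bool n

F : ℕ → Set
F n = Config n → Config n

_≟C_ : ∀ {n} → (x y : Config n) → Dec (x ≡ y)
_≟C_ = ≡-dec _≟B_

allConfigs : (n : ℕ) → List (Config n)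
allConfigs zero = [] ∷ []
allConfigs (suc n) = L.map (false ∷_) (allConfigs n) ++ L.map (true ∷_) (allConfigs n)

flip : ∀ {n} → Config n → Config n
flip = map not

Contains2P1 : ∀ {n} → F n → Set
Contains2P1 f = ∃ λ x → ∃ λ y →
  x ≢ y × x ≢ f x × x ≢ f y × y ≢ f x × y ≢ f y × f x ≢ f y

iter : ∀ {n} → F n → ℕ → Config n → Config n
iter f zero x = x
iter f (suc k) x = f (iter f k x)

Periodic : ∀ {n} → F n → Config n → Set
Periodic f x = ∃ λ k → k ≥ 1 × iter f k x ≡ x

card-Δ⁺ : ∀ {n} → F n → ℕ
card-Δ⁺ {n} f = length (filter (λ x → f x ≟C flip x) (allConfigs n))

-- f ∼ h : the digraphs S(f) and S(h) are isomorphic, i.e. a bijection φ on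
-- configurations with  x → y in S(f)  iff  φ x → φ y in S(h)
_∼_ : ∀ {n} → F n → F n → Set
_∼_ {n} f h = Σ (Config n ⤖ Config n) λ φ →
  let open Bijection φ renaming (to to φ′) in
  ∀ x y → (f x ≡ y → h (φ′ x) ≡ φ′ y) × (h (φ′ x) ≡ φ′ y → f x ≡ y)

-- For a permutation π, |Δ⁺(π f π⁻¹)| counts the x with f x = τ x, where τ = π⁻¹ ∘ flip ∘ π pairs
-- up the configurations. If π sends u₁, u₂, u₃, u₄ to a, b, ā, b̄, composing π with the
-- transposition of a and b changes this pairing only on the u's: {u₁u₃, u₂u₄} becomes
-- {u₂u₃, u₁u₄}. So it suffices to find u's for which the re-pairing matches strictly more arcs
-- of f (a gaining quad): the two conjugates then have different |Δ⁺|, and one of them differs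
-- from f. Without 2P₁, the orbit of a non-fixed p reaches a fixed point, a 2-cycle or a 3-cycle
-- within two steps, and if it is a 3-cycle every other configuration is fixed. n ≥ 3 leaves
-- room for the two further configurations a quad needs, and the second periodic configuration
-- is used only when the orbit ends in a fixed point.

module Submission where

open import Defs
open import Data.Bool using (Bool; true; false; not)
open import Data.Bool.Properties using (not-involutive) renaming (_≟_ to _≟B_)
open import Data.Empty using (⊥-elim)
open import Data.List using (List; []; _∷_; map; filter; length)
open import Data.List.Membership.Propositional using (_∈_; _∉_)
open import Data.List.Membership.Propositional.Properties
  using (∈-map⁺; ∈-++⁺ˡ; ∈-++⁺ʳ; ∈-filter⁺; ∈-filter⁻)
open import Data.List.Relation.Binary.Pointwise using (Pointwise-≡⇒≡)
open import Data.List.Relation.Binary.Sublist.Propositional using (_⊆_; ⊆-refl)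
open import Data.List.Relation.Binary.Sublist.Propositional.Properties
  using (filter⁺; length-mono-≤; to-≋)
open import Data.List.Relation.Unary.All as All using (All; []; _∷_)
import Data.List.Relation.Unary.All.Properties as Allₚ
open import Data.List.Relation.Unary.AllPairs using ([]; _∷_)
open import Data.List.Relation.Unary.Any using (here; there; satisfied)
open import Data.List.Relation.Unary.Unique.Propositional using (Unique)
import Data.List.Relation.Unary.Unique.Propositional.Properties as Uniqueₚ
open import Data.Nat using (ℕ; zero; suc; _+_; _<_; _≥_; _^_; z≤n; s≤s)
open import Data.Nat.Properties
  using (_≟_; _<?_; <-irrefl; ≤∧≢⇒<; ≮⇒≥; <-≤-trans; +-suc; +-identityʳ; +-cancelˡ-<; +-monoˡ-≤;
         ^-monoʳ-≤; m≤m+n; module ≤-Reasoning)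
open import Data.Product as Product using (Σ; ∃; ∃₂; _×_; _,_; proj₁; proj₂; uncurry)
open import Data.Sum as Sum using (_⊎_; inj₁; inj₂)
open import Data.Vec using ([]; _∷_; head; tail; replicate)
import Data.Vec.Properties as Vec
open import Function.Base using (_∘_; const; case_of_)
open import Function.Bundles using (_↔_; Inverse; Bijection; mk↔ₛ′)
open import Function.Construct.Composition using (_↔-∘_)
open import Function.Construct.Identity using (↔-id)
open import Function.Construct.Symmetry using (↔-sym)
open import Function.Properties.Inverse using (↔⇒⤖)
open import Level using (0ℓ)
open import Relation.Binary.Definitions using (DecidableEquality)
open import Relation.Binary.PropositionalEquality using (_≡_; _≢_; refl; sym; trans; cong; subst)
open import Relation.Nullary using (¬_; Dec; yes; no; contradiction)
open import Relation.Nullary.Decidable using (decidable-stable)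
open import Relation.Unary using (Pred; Decidable)

open Inverse using (to; from; strictlyInverseˡ; strictlyInverseʳ)

module Transposition {a} {A : Set a} (_≟_ : DecidableEquality A) (x y : A) where

  swap : A → A
  swap z with z ≟ x | z ≟ y
  ... | yes _ | _     = y
  ... | no _  | yes _ = x
  ... | no _  | no _  = z

  swap-≢ : ∀ {z} → z ≢ x → z ≢ y → swap z ≡ z
  swap-≢ {z} z≢x z≢y with z ≟ x | z ≟ y
  ... | yes z≡x | _       = contradiction z≡x z≢x
  ... | no _    | yes z≡y = contradiction z≡y z≢y
  ... | no _    | no _    = refl

  swap-x : swap x ≡ y
  swap-x with x ≟ x
  ... | yes _  = refl
  ... | no x≢x = contradiction refl x≢x

  swap-y : swap y ≡ x
  swap-y with y ≟ x | y ≟ y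
  ... | yes y≡x | _      = y≡x
  ... | no _    | yes _  = refl
  ... | no _    | no y≢y = contradiction refl y≢y

  swap-involutive : ∀ z → swap (swap z) ≡ z
  swap-involutive z with z ≟ x | z ≟ y
  ... | yes z≡x | _       = trans swap-y (sym z≡x)
  ... | no _    | yes z≡y = trans swap-x (sym z≡y)
  ... | no z≢x  | no z≢y  = swap-≢ z≢x z≢y

  transposition : A ↔ A
  transposition = mk↔ₛ′ swap swap swap-involutive swap-involutive

module _ {a} {A : Set a} (_≟_ : DecidableEquality A) where
  open Transposition _≟_

  permutation-mapping : (ps : List (A × A)) → Unique (map proj₁ ps) → Unique (map proj₂ ps) →
                        Σ (A ↔ A) λ π → All (uncurry λ u t → to π u ≡ t) ps
  permutation-mapping [] _ _ = ↔-id A , []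
  permutation-mapping ((u , t) ∷ ps) (u∉ ∷ us-unique) (t∉ ∷ ts-unique)
    with π , π-maps ← permutation-mapping ps us-unique ts-unique =
    transposition (to π u) t ↔-∘ π ,
    swap-x (to π u) t ∷ All.zipWith keep (π-maps , All.zip (Allₚ.map⁻ u∉ , Allₚ.map⁻ t∉))
    where
    keep : ∀ {v s} → to π v ≡ s × u ≢ v × t ≢ s → swap (to π u) t (to π v) ≡ s
    keep (refl , u≢v , t≢πv) =
      swap-≢ (to π u) t (u≢v ∘ sym ∘ Bijection.injective (↔⇒⤖ π)) (t≢πv ∘ sym)

unique₄ : ∀ {a} {A : Set a} {x y z w : A} →
          x ≢ y → x ≢ z → x ≢ w → y ≢ z → y ≢ w → z ≢ w → Unique (x ∷ y ∷ z ∷ w ∷ [])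
unique₄ x≢y x≢z x≢w y≢z y≢w z≢w =
  (x≢y ∷ x≢z ∷ x≢w ∷ []) ∷ (y≢z ∷ y≢w ∷ []) ∷ (z≢w ∷ []) ∷ [] ∷ []

conj : ∀ {n} → Config n ↔ Config n → F n → F n
conj π f = to π ∘ f ∘ from π

module _ {n} (π : Config n ↔ Config n) (f : F n) where

  conj-arc⁺ : ∀ {x y} → f x ≡ y → conj π f (to π x) ≡ to π y
  conj-arc⁺ {x} refl = cong (to π ∘ f) (strictlyInverseʳ π x)

  conj-arc⁻ : ∀ {x y} → conj π f (to π x) ≡ to π y → f x ≡ y
  conj-arc⁻ eq = Bijection.injective (↔⇒⤖ π) (trans (sym (conj-arc⁺ refl)) eq)

  conj-∼ : conj π f ∼ f
  conj-∼ = ↔⇒⤖ (↔-sym π) , λ x y →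
    (λ eq → trans (sym (strictlyInverseʳ π _)) (cong (from π) eq)) ,
    (λ eq → trans (cong (to π) eq) (strictlyInverseˡ π y))

filter-length-< : ∀ {A : Set} {P Q : Pred A 0ℓ} (P? : Decidable P) (Q? : Decidable Q) {xs z} →
                  (∀ {x} → P x → Q x) → z ∈ xs → Q z → ¬ P z →
                  length (filter P? xs) < length (filter Q? xs)
filter-length-< P? Q? {xs} {z} P⇒Q z∈xs Qz ¬Pz = ≤∧≢⇒< (length-mono-≤ P⊆Q) λ eq →
  ¬Pz (proj₂ (∈-filter⁻ P? {xs = xs}
    (subst (z ∈_) (sym (Pointwise-≡⇒≡ (to-≋ eq P⊆Q))) (∈-filter⁺ Q? z∈xs Qz))))
  where
  P⊆Q : filter P? xs ⊆ filter Q? xs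
  P⊆Q = filter⁺ P? Q? {as = xs} (λ { refl → P⇒Q }) ⊆-refl

∈-allConfigs : ∀ {n} (x : Config n) → x ∈ allConfigs n
∈-allConfigs []                  = here refl
∈-allConfigs {suc n} (false ∷ x) = ∈-++⁺ˡ (∈-map⁺ (false ∷_) (∈-allConfigs x))
∈-allConfigs {suc n} (true ∷ x)  =
  ∈-++⁺ʳ (map (false ∷_) (allConfigs n)) (∈-map⁺ (true ∷_) (∈-allConfigs x))

¬∀⇒∃¬ : ∀ {n} {P : Pred (Config n) 0ℓ} → Decidable P → ¬ (∀ x → P x) → ∃ λ x → ¬ P x
¬∀⇒∃¬ {n} P? ¬∀P =
  satisfied (Allₚ.¬All⇒Any¬ P? (allConfigs n) λ all → ¬∀P λ x → All.lookup all (∈-allConfigs x))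

card-Δ⁺-< : ∀ {n} {h h′ : F n} {z} → (∀ x → h x ≡ flip x → h′ x ≡ flip x) →
            h′ z ≡ flip z → h z ≢ flip z → card-Δ⁺ h < card-Δ⁺ h′
card-Δ⁺-< {z = z} Δ⁺⊆ = filter-length-< _ _ (Δ⁺⊆ _) (∈-allConfigs z)

flip-involutive : ∀ {n} (x : Config n) → flip (flip x) ≡ x
flip-involutive x =
  trans (sym (Vec.map-∘ not not x)) (trans (Vec.map-cong not-involutive x) (Vec.map-id x))

flip≡⇒≡flip : ∀ {n} {z c : Config n} → flip z ≡ c → z ≡ flip c
flip≡⇒≡flip {z = z} refl = sym (flip-involutive z)

-- Pairing u₁ with u₃ and u₂ with u₄, the re-pairing u₂–u₃, u₁–u₄ keeps every arc of f
-- between partners and gains one.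
record GainingQuad {n} (f : F n) (u₁ u₂ u₃ u₄ : Config n) : Set where
  field
    distinct    : Unique (u₁ ∷ u₂ ∷ u₃ ∷ u₄ ∷ [])
    arc₁₃⇒arc₂₃ : f u₁ ≡ u₃ → f u₂ ≡ u₃
    arc₃₁⇒arc₃₂ : f u₃ ≡ u₁ → f u₃ ≡ u₂
    arc₂₄⇒arc₁₄ : f u₂ ≡ u₄ → f u₁ ≡ u₄
    arc₄₂⇒arc₄₁ : f u₄ ≡ u₂ → f u₄ ≡ u₁
    gain        : (f u₂ ≡ u₃ × f u₁ ≢ u₃) ⊎ (f u₃ ≡ u₂ × f u₃ ≢ u₁)

HasGainingQuad : ∀ {n} → F n → Set
HasGainingQuad f = ∃₂ λ u₁ u₂ → ∃₂ λ u₃ u₄ → GainingQuad f u₁ u₂ u₃ u₄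

GainingQuad-conj : ∀ {n} {f : F n} {u₁ u₂ u₃ u₄ t₁ t₂ t₃ t₄} (π : Config n ↔ Config n) →
  All (uncurry λ u t → to π u ≡ t) ((u₁ , t₁) ∷ (u₂ , t₂) ∷ (u₃ , t₃) ∷ (u₄ , t₄) ∷ []) →
  GainingQuad f u₁ u₂ u₃ u₄ → GainingQuad (conj π f) t₁ t₂ t₃ t₄
GainingQuad-conj {f = f} π (refl ∷ refl ∷ refl ∷ refl ∷ []) q = record
  { distinct    = Uniqueₚ.map⁺ (Bijection.injective (↔⇒⤖ π)) distinct
  ; arc₁₃⇒arc₂₃ = arc⁺ ∘ arc₁₃⇒arc₂₃ ∘ arc⁻
  ; arc₃₁⇒arc₃₂ = arc⁺ ∘ arc₃₁⇒arc₃₂ ∘ arc⁻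
  ; arc₂₄⇒arc₁₄ = arc⁺ ∘ arc₂₄⇒arc₁₄ ∘ arc⁻
  ; arc₄₂⇒arc₄₁ = arc⁺ ∘ arc₄₂⇒arc₄₁ ∘ arc⁻
  ; gain        = Sum.map (Product.map arc⁺ (_∘ arc⁻)) (Product.map arc⁺ (_∘ arc⁻)) gain
  }
  where
  open GainingQuad q
  arc⁺ = conj-arc⁺ π f
  arc⁻ = conj-arc⁻ π f

module SwapConj {n} {a b : Config n}
  (ā≢a : flip a ≢ a) (ā≢b : flip a ≢ b) (b̄≢a : flip b ≢ a) (b̄≢b : flip b ≢ b)
  {h : F n} (q : GainingQuad h a b (flip a) (flip b)) where
  open Transposition _≟C_ a b
  open GainingQuad q

  σ : Config n ↔ Config n
  σ = transposition

  private
    conj-at : ∀ {z z′ t} → swap z ≡ z′ → h z′ ≡ t → swap t ≡ flip z → conj σ h z ≡ flip z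
    conj-at refl refl swap-t = swap-t

  Δ⁺-conj-⊇ : ∀ z → h z ≡ flip z → conj σ h z ≡ flip z
  Δ⁺-conj-⊇ z hz = cases (z ≟C a) (z ≟C b) (z ≟C flip a) (z ≟C flip b)
    where
    cases : Dec (z ≡ a) → Dec (z ≡ b) → Dec (z ≡ flip a) → Dec (z ≡ flip b) → conj σ h z ≡ flip z
    cases (yes refl) _ _ _ = conj-at swap-x (arc₁₃⇒arc₂₃ hz) (swap-≢ ā≢a ā≢b)
    cases _ (yes refl) _ _ = conj-at swap-y (arc₂₄⇒arc₁₄ hz) (swap-≢ b̄≢a b̄≢b)
    cases _ _ (yes refl) _ = conj-at (swap-≢ ā≢a ā≢b) (arc₃₁⇒arc₃₂ (trans hz (flip-involutive a)))
                                     (trans swap-y (sym (flip-involutive a)))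
    cases _ _ _ (yes refl) = conj-at (swap-≢ b̄≢a b̄≢b) (arc₄₂⇒arc₄₁ (trans hz (flip-involutive b)))
                                     (trans swap-x (sym (flip-involutive b)))
    cases (no z≢a) (no z≢b) (no z≢ā) (no z≢b̄) =
      conj-at (swap-≢ z≢a z≢b) hz (swap-≢ (z≢ā ∘ flip≡⇒≡flip) (z≢b̄ ∘ flip≡⇒≡flip))

  Δ⁺-conj-new : ∃ λ z → conj σ h z ≡ flip z × h z ≢ flip z
  Δ⁺-conj-new with gain
  ... | inj₁ (hb≡ā , ha≢ā) = a , conj-at swap-x hb≡ā (swap-≢ ā≢a ā≢b) , ha≢ā
  ... | inj₂ (hā≡b , hā≢a) = flip a ,
    conj-at (swap-≢ ā≢a ā≢b) hā≡b (trans swap-y (sym (flip-involutive a))) ,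
    λ hā≡ā̄ → hā≢a (trans hā≡ā̄ (flip-involutive a))

  card-Δ⁺-conj-< : card-Δ⁺ h < card-Δ⁺ (conj σ h)
  card-Δ⁺-conj-< = let z , new , old = Δ⁺-conj-new in card-Δ⁺-< Δ⁺-conj-⊇ new old

conjugates-with-card-Δ⁺-< : ∀ {n} {f : F n} {u₁ u₂ u₃ u₄ a b : Config n} →
  GainingQuad f u₁ u₂ u₃ u₄ → Unique (a ∷ b ∷ flip a ∷ flip b ∷ []) →
  Σ (F n) λ h₁ → Σ (F n) λ h₂ → h₁ ∼ f × h₂ ∼ f × card-Δ⁺ h₁ < card-Δ⁺ h₂
conjugates-with-card-Δ⁺-< {f = f} {u₁} {u₂} {u₃} {u₄} {a} {b} q
  targets@((_ ∷ a≢ā ∷ a≢b̄ ∷ []) ∷ (b≢ā ∷ b≢b̄ ∷ []) ∷ _)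
  with π , π-maps ← permutation-mapping _≟C_ ((u₁ , a) ∷ (u₂ , b) ∷ (u₃ , flip a) ∷ (u₄ , flip b) ∷ [])
                                          (GainingQuad.distinct q) targets =
  conj π f , conj (σ ↔-∘ π) f , conj-∼ π f , conj-∼ (σ ↔-∘ π) f , card-Δ⁺-conj-<
  where open SwapConj (a≢ā ∘ sym) (b≢ā ∘ sym) (a≢b̄ ∘ sym) (b≢b̄ ∘ sym) (GainingQuad-conj π π-maps q)

flip-distinct-pair : ∀ m → ∃₂ λ (a b : Config (2 + m)) → Unique (a ∷ b ∷ flip a ∷ flip b ∷ [])
flip-distinct-pair m = replicate _ false , true ∷ replicate _ false ,
                       unique₄ (λ ()) (λ ()) (λ ()) (λ ()) (λ ()) (λ ())

branch : ∀ {n} → Bool → List (Config (suc n)) → List (Config n)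
branch b xs = map tail (filter ((_≟B b) ∘ head) xs)

∈-branch : ∀ {n b} {x : Config n} {xs} → b ∷ x ∈ xs → x ∈ branch b xs
∈-branch x∈xs = ∈-map⁺ tail (∈-filter⁺ _ x∈xs refl)

length-branches : ∀ {n} (xs : List (Config (suc n))) →
                  length (branch false xs) + length (branch true xs) ≡ length xs
length-branches []                 = refl
length-branches ((false ∷ _) ∷ xs) = cong suc (length-branches xs)
length-branches ((true ∷ _) ∷ xs)  = trans (+-suc _ _) (cong suc (length-branches xs))

∃-∉ : ∀ n (xs : List (Config n)) → length xs < 2 ^ n → ∃ λ c → c ∉ xs
∃-∉ zero    []      _        = [] , λ ()
∃-∉ zero    (_ ∷ _) (s≤s ())
∃-∉ (suc n) xs      lt with length (branch false xs) <? 2 ^ n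
... | yes lt₀ = let c , c∉ = ∃-∉ n (branch false xs) lt₀ in false ∷ c , c∉ ∘ ∈-branch
... | no ≮₀   = let c , c∉ = ∃-∉ n (branch true xs) lt₁ in true ∷ c , c∉ ∘ ∈-branch
  where
  open ≤-Reasoning
  lt₁ : length (branch true xs) < 2 ^ n
  lt₁ = +-cancelˡ-< (2 ^ n) _ _ (begin-strict
    2 ^ n + length (branch true xs)                     ≤⟨ +-monoˡ-≤ _ (≮⇒≥ ≮₀) ⟩
    length (branch false xs) + length (branch true xs)  ≡⟨ length-branches xs ⟩
    length xs                                           <⟨ lt ⟩
    2 ^ suc n                                           ≡⟨ cong (2 ^ n +_) (+-identityʳ (2 ^ n)) ⟩
    2 ^ n + 2 ^ n                                       ∎)

fresh : ∀ {m} (x₁ x₂ x₃ x₄ : Config (3 + m)) → ∃ λ c → c ≢ x₁ × c ≢ x₂ × c ≢ x₃ × c ≢ x₄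
fresh {m} x₁ x₂ x₃ x₄ =
  let c , c∉ = ∃-∉ _ (x₁ ∷ x₂ ∷ x₃ ∷ x₄ ∷ []) 4<2^[3+m] in
  c , c∉ ∘ here , c∉ ∘ there ∘ here , c∉ ∘ there ∘ there ∘ here , c∉ ∘ there ∘ there ∘ there ∘ here
  where
  4<2^[3+m] : 4 < 2 ^ (3 + m)
  4<2^[3+m] = <-≤-trans (s≤s (s≤s (s≤s (s≤s (s≤s z≤n))))) (^-monoʳ-≤ 2 (m≤m+n 3 m))

one-of-two-≢ : ∀ {n} {P : Pred (Config n) 0ℓ} {x y} → x ≢ y → P x → P y → ∀ q → ∃ λ z → z ≢ q × P z
one-of-two-≢ {x = x} {y} x≢y Px Py q with x ≟C q
... | yes refl = y , x≢y ∘ sym , Py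
... | no x≢q   = x , x≢q , Px

module Dynamics {n} (f : F n) where

  iter-comm : ∀ k x → iter f k (f x) ≡ f (iter f k x)
  iter-comm zero    x = refl
  iter-comm (suc k) x = cong f (iter-comm k x)

  iter-fixed : ∀ {q} → f q ≡ q → ∀ k → iter f k q ≡ q
  iter-fixed fq≡q zero    = refl
  iter-fixed fq≡q (suc k) = trans (cong f (iter-fixed fq≡q k)) fq≡q

  periodic-step : ∀ {x} → Periodic f x → Periodic f (f x)
  periodic-step {x} (k , k≥1 , fᵏx≡x) = k , k≥1 , trans (iter-comm k x) (cong f fᵏx≡x)

  periodic-into-fixed : ∀ {x q} → f q ≡ q → f x ≡ q → Periodic f x → x ≡ q
  periodic-into-fixed {x} fq≡q refl (suc k , _ , fᵏ⁺¹x≡x) =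
    trans (sym fᵏ⁺¹x≡x) (trans (sym (iter-comm k x)) (iter-fixed fq≡q k))

  periodic-off-arc : ∀ {p q z} → f p ≡ q → p ≢ q → f q ≡ q → z ≢ q → Periodic f z →
                     z ≢ p × f z ≢ p × f z ≢ q
  periodic-off-arc fp≡q p≢q fq≡q z≢q z-per =
    (λ { refl → p≢q (periodic-into-fixed fq≡q fp≡q z-per) }) ,
    (λ fz≡p → p≢q (trans (sym fz≡p)
                     (periodic-into-fixed fq≡q (trans (cong f fz≡p) fp≡q) (periodic-step z-per)))) ,
    (λ fz≡q → z≢q (periodic-into-fixed fq≡q fz≡q z-per))

  ¬2P1⇒images-meet : ¬ Contains2P1 f → ∀ {x y} →
                     x ≢ y → x ≢ f x → x ≢ f y → y ≢ f x → y ≢ f y → f x ≡ f y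
  ¬2P1⇒images-meet no2P1 {x} {y} x≢y x≢fx x≢fy y≢fx y≢fy =
    decidable-stable (f x ≟C f y) λ fx≢fy → no2P1 (x , y , x≢y , x≢fx , x≢fy , y≢fx , y≢fy , fx≢fy)

  3-cycle-complement-fixed : ¬ Contains2P1 f → ∀ {p q r w} → f p ≡ q → f q ≡ r → f r ≡ p →
                             p ≢ q → p ≢ r → q ≢ r → w ≢ p → w ≢ q → w ≢ r → f w ≡ w
  3-cycle-complement-fixed no2P1 {p} {q} {r} {w} fp≡q fq≡r fr≡p p≢q p≢r q≢r w≢p w≢q w≢r =
    decidable-stable (f w ≟C w) λ fw≢w → case f w ≟C p of λ where
      (yes fw≡p) → p≢r (trans (sym fw≡p)
                         (meet fw≢w w≢q fq≡r w≢r q≢r (λ q≡fw → p≢q (sym (trans q≡fw fw≡p)))))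
      (no fw≢p)  → let fw≡q = meet fw≢w w≢p fp≡q w≢q p≢q (fw≢p ∘ sym) in
                   fw≢p (meet fw≢w w≢r fr≡p w≢p (p≢r ∘ sym) (λ r≡fw → q≢r (sym (trans r≡fw fw≡q))))
    where
    meet : f w ≢ w → ∀ {c c′} → w ≢ c → f c ≡ c′ → w ≢ c′ → c ≢ c′ → c ≢ f w → f w ≡ c′
    meet fw≢w w≢c refl w≢fc c≢fc c≢fw = ¬2P1⇒images-meet no2P1 w≢c (fw≢w ∘ sym) w≢fc c≢fw c≢fc

  gainingQuad-at-arc : ∀ {u₁ u₂ u₃ u₄} → Unique (u₁ ∷ u₂ ∷ u₃ ∷ u₄ ∷ []) →
                       f u₂ ≡ u₃ → f u₁ ≢ u₃ → f u₃ ≢ u₁ → f u₄ ≢ u₂ → HasGainingQuad f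
  gainingQuad-at-arc distinct@(_ ∷ _ ∷ (u₃≢u₄ ∷ []) ∷ _) fu₂≡u₃ fu₁≢u₃ fu₃≢u₁ fu₄≢u₂ =
    _ , _ , _ , _ , record
      { distinct    = distinct
      ; arc₁₃⇒arc₂₃ = const fu₂≡u₃
      ; arc₃₁⇒arc₃₂ = ⊥-elim ∘ fu₃≢u₁
      ; arc₂₄⇒arc₁₄ = λ fu₂≡u₄ → contradiction (trans (sym fu₂≡u₃) fu₂≡u₄) u₃≢u₄
      ; arc₄₂⇒arc₄₁ = ⊥-elim ∘ fu₄≢u₂
      ; gain        = inj₁ (fu₂≡u₃ , fu₁≢u₃)
      }

  gainingQuad-at-2-cycle : ∀ {u₁ u₂ u₃ u₄} → Unique (u₁ ∷ u₂ ∷ u₃ ∷ u₄ ∷ []) →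
                           f u₂ ≡ u₃ → f u₃ ≡ u₂ → f u₄ ≢ u₂ → HasGainingQuad f
  gainingQuad-at-2-cycle distinct@((u₁≢u₂ ∷ _) ∷ _ ∷ (u₃≢u₄ ∷ []) ∷ _) fu₂≡u₃ fu₃≡u₂ fu₄≢u₂ =
    _ , _ , _ , _ , record
      { distinct    = distinct
      ; arc₁₃⇒arc₂₃ = const fu₂≡u₃
      ; arc₃₁⇒arc₃₂ = const fu₃≡u₂
      ; arc₂₄⇒arc₁₄ = λ fu₂≡u₄ → contradiction (trans (sym fu₂≡u₃) fu₂≡u₄) u₃≢u₄
      ; arc₄₂⇒arc₄₁ = ⊥-elim ∘ fu₄≢u₂
      ; gain        = inj₂ (fu₃≡u₂ , λ fu₃≡u₁ → u₁≢u₂ (trans (sym fu₃≡u₁) fu₃≡u₂))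
      }

module _ {m} (f : F (3 + m)) where
  open Dynamics f

  gainingQuad-into-fixed : ∀ {p q} → f p ≡ q → p ≢ q → f q ≡ q →
                           (∃ λ x → ∃ λ y → x ≢ y × Periodic f x × Periodic f y) → HasGainingQuad f
  gainingQuad-into-fixed {p} {q} fp≡q p≢q fq≡q (_ , _ , x≢y , x-per , y-per)
    with one-of-two-≢ x≢y x-per y-per q
  ... | z , z≢q , z-per with periodic-off-arc fp≡q p≢q fq≡q z≢q z-per | fresh p q z z
  ... | z≢p , fz≢p , fz≢q | w , w≢p , w≢q , w≢z , _ with f w ≟C p
  ... | no fw≢p  = gainingQuad-at-arc (unique₄ z≢p z≢q (w≢z ∘ sym) p≢q (w≢p ∘ sym) (w≢q ∘ sym))
                     fp≡q fz≢q (λ fq≡z → z≢q (trans (sym fq≡z) fq≡q)) fw≢p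
  ... | yes fw≡p = gainingQuad-at-arc (unique₄ w≢p w≢q w≢z p≢q (z≢p ∘ sym) (z≢q ∘ sym))
                     fp≡q (p≢q ∘ trans (sym fw≡p)) (λ fq≡w → w≢q (trans (sym fq≡w) fq≡q)) fz≢p

  gainingQuad-around-2-cycle : ∀ {p q} → f p ≡ q → f q ≡ p → p ≢ q → HasGainingQuad f
  gainingQuad-around-2-cycle {p} {q} fp≡q fq≡p p≢q with fresh p q p p
  ... | w₁ , w₁≢p , w₁≢q , _ with fresh p q w₁ w₁
  ... | w₂ , w₂≢p , w₂≢q , w₂≢w₁ , _ with f w₂ ≟C p
  ... | no fw₂≢p  =
    gainingQuad-at-2-cycle (unique₄ w₁≢p w₁≢q (w₂≢w₁ ∘ sym) p≢q (w₂≢p ∘ sym) (w₂≢q ∘ sym))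
      fp≡q fq≡p fw₂≢p
  ... | yes fw₂≡p =
    gainingQuad-at-2-cycle (unique₄ w₁≢q w₁≢p (w₂≢w₁ ∘ sym) (p≢q ∘ sym) (w₂≢q ∘ sym) (w₂≢p ∘ sym))
      fq≡p fp≡q (p≢q ∘ trans (sym fw₂≡p))

  gainingQuad-around-3-cycle : ¬ Contains2P1 f → ∀ {p q r} → f p ≡ q → f q ≡ r → f r ≡ p →
                               p ≢ q → p ≢ r → q ≢ r → HasGainingQuad f
  gainingQuad-around-3-cycle no2P1 {p} {q} {r} fp≡q fq≡r fr≡p p≢q p≢r q≢r with fresh p q r r
  ... | w₁ , w₁≢p , w₁≢q , w₁≢r , _ with fresh p q r w₁
  ... | w₂ , w₂≢p , w₂≢q , w₂≢r , w₂≢w₁ =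
    gainingQuad-at-arc (unique₄ w₁≢p w₁≢q (w₂≢w₁ ∘ sym) p≢q (w₂≢p ∘ sym) (w₂≢q ∘ sym)) fp≡q
      (λ fw₁≡q → w₁≢q (trans (sym (fixed w₁≢p w₁≢q w₁≢r)) fw₁≡q))
      (λ fq≡w₁ → w₁≢r (trans (sym fq≡w₁) fq≡r))
      (λ fw₂≡p → w₂≢p (trans (sym (fixed w₂≢p w₂≢q w₂≢r)) fw₂≡p))
    where
    fixed : ∀ {w} → w ≢ p → w ≢ q → w ≢ r → f w ≡ w
    fixed = 3-cycle-complement-fixed no2P1 fp≡q fq≡r fr≡p p≢q p≢r q≢r

  module _ (no2P1 : ¬ Contains2P1 f)
           (periodic : ∃ λ x → ∃ λ y → x ≢ y × Periodic f x × Periodic f y) where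

    gainingQuad-from-path : ∀ {p q r} → f p ≡ q → f q ≡ r → p ≢ q → p ≢ r → q ≢ r →
                            HasGainingQuad f
    gainingQuad-from-path {p} {q} {r} fp≡q fq≡r p≢q p≢r q≢r with f r ≟C r | f r ≟C q | f r ≟C p
    ... | yes fr≡r | _        | _        = gainingQuad-into-fixed fq≡r q≢r fr≡r periodic
    ... | no _     | yes fr≡q | _        = gainingQuad-around-2-cycle fq≡r fr≡q q≢r
    ... | no _     | no _     | yes fr≡p = gainingQuad-around-3-cycle no2P1 fp≡q fq≡r fr≡p p≢q p≢r q≢r
    ... | no fr≢r  | no fr≢q  | no fr≢p  = contradiction (trans (sym fp≡q) images-meet) (fr≢q ∘ sym)
      where
      images-meet : f p ≡ f r
      images-meet = ¬2P1⇒images-meet no2P1 p≢r (λ p≡fp → p≢q (trans p≡fp fp≡q)) (fr≢p ∘ sym)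
                                     (λ r≡fp → q≢r (sym (trans r≡fp fp≡q))) (fr≢r ∘ sym)

    gainingQuad-from-arc : ∀ {p q} → f p ≡ q → p ≢ q → HasGainingQuad f
    gainingQuad-from-arc {p} {q} fp≡q p≢q with f q ≟C q | f q ≟C p
    ... | yes fq≡q | _        = gainingQuad-into-fixed fp≡q p≢q fq≡q periodic
    ... | no _     | yes fq≡p = gainingQuad-around-2-cycle fp≡q fq≡p p≢q
    ... | no fq≢q  | no fq≢p  = gainingQuad-from-path fp≡q refl p≢q (fq≢p ∘ sym) (fq≢q ∘ sym)

lemma7 : (n : ℕ) → n ≥ 3 → (f : F n) → ¬ (∀ x → f x ≡ x) → ¬ Contains2P1 f →
    (∃ λ x → ∃ λ y → x ≢ y × Periodic f x × Periodic f y) →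
    Σ (F n) λ h → (h ∼ f) × card-Δ⁺ h ≢ card-Δ⁺ f
lemma7 (suc (suc (suc m))) (s≤s (s≤s (s≤s z≤n))) f f≢id no2P1 periodic
  with p , fp≢p ← ¬∀⇒∃¬ (λ x → f x ≟C x) f≢id
  with _ , _ , _ , _ , quad ← gainingQuad-from-arc f no2P1 periodic refl (fp≢p ∘ sym)
  with _ , _ , targets ← flip-distinct-pair (suc m)
  with h₁ , h₂ , h₁∼f , h₂∼f , h₁<h₂ ← conjugates-with-card-Δ⁺-< quad targets
  with card-Δ⁺ h₁ ≟ card-Δ⁺ f
... | no h₁≉f  = h₁ , h₁∼f , h₁≉f
... | yes h₁≈f = h₂ , h₂∼f , λ h₂≈f → <-irrefl (trans h₁≈f (sym h₂≈f)) h₁<h₂
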